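{- If $G$ is a connected graph of maximum degree $\Delta=3$, then $\chi_o(G)\le 4$.
   Context: All graphs are finite, simple and undirected. A proper vertex coloring $\varphi$ of a graph $G$ is called an odd coloring if for every non-isolated vertex $x$ of $G$ there is a color $c$ such that the number of neighbors $y\in N(x)$ with $\varphi(y)=c$ is odd. The odd chromatic number $\chi_o(G)$ is the minimum number of colors in an odd coloring of $G$. -}

module Defs where

open import Data.Nat using (ℕ; zero; suc; _≤_)
open import Data.Nat using (_%_)
open import Data.Bool using (Bool; true; false; T)
open import Data.Fin using (Fin)
open import Data.Fin.Properties using (_≟_)
open import Data.List using (List; length; filter; allFin)
open import Data.Product using (Σ; _×_; ∃; ∃-syntax)
open import Relation.Nullary using (¬_)
open import Relation.Binary.PropositionalEquality using (_≡_)
open import Data.Bool.Properties using (T?)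

Odd : ℕ → Set
Odd m = m % 2 ≡ 1

record Graph (n : ℕ) : Set where
  field
    adj     : Fin n → Fin n → Bool
    symm    : ∀ x y → adj x y ≡ adj y x
    irrefl  : ∀ x → adj x x ≡ false
open Graph public

N : ∀ {n} → Graph n → Fin n → List (Fin n)
N G x = filter (λ y → T? (adj G x y)) (allFin _)

degree : ∀ {n} → Graph n → Fin n → ℕ
degree G x = length (N G x)

MaxDegree : ∀ {n} → Graph n → ℕ → Set
MaxDegree G d = (∀ x → degree G x ≤ d) × (∃[ x ] degree G x ≡ d)

data Reach {n} (G : Graph n) : Fin n → Fin n → Set where
  here : ∀ {x} → Reach G x x
  step : ∀ {x y z} → T (adj G x y) → Reach G y z → Reach G x z

Connected : ∀ {n} → Graph n → Set
Connected G = ∀ x y → Reach G x y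

Proper : ∀ {n k} → Graph n → (Fin n → Fin k) → Set
Proper G φ = ∀ x y → T (adj G x y) → ¬ (φ x ≡ φ y)

colorCount : ∀ {n k} → Graph n → (Fin n → Fin k) → Fin n → Fin k → ℕ
colorCount G φ x c = length (filter (λ y → φ y ≟ c) (N G x))

Isolated : ∀ {n} → Graph n → Fin n → Set
Isolated G x = degree G x ≡ 0

OddColoring : ∀ {n k} → Graph n → (Fin n → Fin k) → Set
OddColoring G φ =
  Proper G φ × (∀ x → ¬ Isolated G x → ∃[ c ] Odd (colorCount G φ x c))

OddChromaticAtMost : ∀ {n} → Graph n → ℕ → Set
OddChromaticAtMost G k = Σ (Fin _ → Fin k) (OddColoring G)

-- Call u and v conflicting if they are adjacent or are the two neighbours of a vertex of
-- degree 2. When Δ ≤ 3, a colouring that separates conflicting vertices is odd: a vertex of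
-- degree 1 or 3 always has a colour class of odd size, and one of degree 2 sees two colours
-- once each. Such a colouring with 4 colours is found greedily, colouring first the vertices
-- of degree ≠ 2 and then those of degree 2 in decreasing order of their distance to a vertex
-- of degree ≠ 2 (one exists, since Δ = 3 and G is connected). Each vertex then conflicts with
-- at most 3 vertices coloured before it: a vertex of degree ≠ 2 with at most one through each
-- of its neighbours, a vertex of degree 2 with at most two through one neighbour and at most
-- one through its neighbour closer to a vertex of degree ≠ 2.

module Submission where

open import Data.Nat using (ℕ)
open import Defs

open import Data.Nat using (zero; suc; _+_; _*_; _∸_; _≤_; _<_; _%_; z≤n; s≤s; z<s; s≤s⁻¹)
open import Data.Nat.Properties as ℕ
  using ( ≤-reflexive; ≤-trans; <-irrefl; <-cmp; <⇒≢; <⇒≯; ≮⇒≥; ≤∧≢⇒<; m<1+n⇒m≤n; 1+n≰n; n≤1+n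
        ; m≤m+n; +-comm; +-cancelˡ-≡; +-mono-≤; +-mono-<-≤; +-mono-≤-<; +-monoʳ-<
        ; *-monoˡ-≤; *-identityʳ; ∸-monoʳ-<; _<?_; module ≤-Reasoning)
open import Data.Bool using (T)
open import Data.Bool.Properties using (T?)
open import Data.Fin using (Fin; toℕ) renaming (zero to fzero)
open import Data.Fin.Properties using (_≟_; toℕ<n; toℕ-injective; any?; ¬∀⟶∃¬; injective⇒≤)
open import Data.List using (List; []; _∷_; length; filter; map; concatMap; allFin; lookup; _++_)
open import Data.List.Properties
  using (length-++; length-map; length-filter; filter-accept; filter-reject; filter-notAll)
open import Data.List.Extrema.Nat using (max; xs≤max)
open import Data.List.Membership.Propositional using (_∈_; _∉_)
open import Data.List.Membership.Propositional.Properties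
  using (∈-map⁺; ∈-filter⁺; ∈-filter⁻; ∈-allFin; ∈-concat⁺′)
import Data.List.Membership.DecPropositional as DecMembership
open import Data.List.Relation.Unary.Any as Any using (here; there)
open import Data.List.Relation.Unary.Any.Properties using (lookup-index)
import Data.List.Relation.Unary.All as All
open import Data.List.Relation.Unary.AllPairs using (_∷_)
open import Data.List.Relation.Unary.Unique.Propositional using (Unique)
import Data.List.Relation.Unary.Unique.Propositional.Properties as Unique
open import Data.Product using (_×_; _,_; proj₁; proj₂; ∃; ∃-syntax)
open import Data.Sum using (_⊎_; inj₁; inj₂)
open import Function using (_∘_)
open import Function.Definitions using (Injective)
open import Relation.Binary.Definitions using (tri<; tri≈; tri>)
open import Relation.Nullary using (¬_; Dec; yes; no; contradiction)
open import Relation.Nullary.Decidable using (_⊎-dec_; _×-dec_; ¬?)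
open import Relation.Unary using (Pred; Decidable)
open import Relation.Binary.PropositionalEquality

missing-colour : ∀ {d} (cs : List (Fin (suc d))) → length cs ≤ d → ∃[ c ] c ∉ cs
missing-colour {d} cs len = ¬∀⟶∃¬ (suc d) (_∈ cs) (_∈? cs) not-all-used
  where
  open DecMembership (_≟_ {n = suc d}) using (_∈?_)

  not-all-used : ¬ (∀ c → c ∈ cs)
  not-all-used ∈cs = 1+n≰n (≤-trans (injective⇒≤ index-injective) len)
    where
    index-injective : Injective _≡_ _≡_ (λ c → Any.index (∈cs c))
    index-injective {c} {c′} eq =
      trans (lookup-index (∈cs c)) (trans (cong (lookup cs) eq) (sym (lookup-index (∈cs c′))))

sup : ∀ {n} → (Fin n → ℕ) → ℕ
sup f = max 0 (map f (allFin _))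

≤-sup : ∀ {n} (f : Fin n → ℕ) i → f i ≤ sup f
≤-sup f i = All.lookup (xs≤max 0 (map f (allFin _))) (∈-map⁺ f (∈-allFin i))

least-witness : ∀ {p} {Q : ℕ → Set p} → Decidable Q → ∀ b → Q b →
                ∃[ j ] Q j × (∀ {i} → i < j → ¬ Q i)
least-witness Q? b qb with Q? 0
... | yes q0 = 0 , q0 , λ ()
least-witness Q? zero q0 | no ¬q0 = contradiction q0 ¬q0
least-witness Q? (suc b) qb | no ¬q0 with least-witness (Q? ∘ suc) b qb
... | j , qj , below = suc j , qj , λ { {zero} _ → ¬q0 ; {suc i} i<j → below (s≤s⁻¹ i<j) }

module _ {a b} {A : Set a} {B : Set b} (f : A → List B) where

  length-concatMap-≤ : ∀ xs {k} → (∀ {x} → x ∈ xs → length (f x) ≤ k) →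
                       length (concatMap f xs) ≤ length xs * k
  length-concatMap-≤ [] _ = z≤n
  length-concatMap-≤ (x ∷ xs) bound = begin
    length (f x ++ concatMap f xs)         ≡⟨ length-++ (f x) ⟩
    length (f x) + length (concatMap f xs) ≤⟨ +-mono-≤ (bound (here refl))
                                                (length-concatMap-≤ xs (bound ∘ there)) ⟩
    _                                      ∎
    where open ≤-Reasoning

  length-concatMap-< : ∀ xs {k y} → y ∈ xs → length (f y) < k →
                       (∀ {x} → x ∈ xs → length (f x) ≤ k) → length (concatMap f xs) < length xs * k
  length-concatMap-< (x ∷ xs) (here refl) fy<k bound = begin-strict
    length (f x ++ concatMap f xs)         ≡⟨ length-++ (f x) ⟩
    length (f x) + length (concatMap f xs) <⟨ +-mono-<-≤ fy<k (length-concatMap-≤ xs (bound ∘ there)) ⟩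
    _                                      ∎
    where open ≤-Reasoning
  length-concatMap-< (x ∷ xs) (there y∈xs) fy<k bound = begin-strict
    length (f x ++ concatMap f xs)         ≡⟨ length-++ (f x) ⟩
    length (f x) + length (concatMap f xs) <⟨ +-mono-≤-< (bound (here refl))
                                                 (length-concatMap-< xs y∈xs fy<k (bound ∘ there)) ⟩
    _                                      ∎
    where open ≤-Reasoning

length-filter-∷ : ∀ {a p} {A : Set a} {P : Pred A p} (P? : Decidable P) x xs →
                  length (filter P? (x ∷ xs)) ≤ suc (length (filter P? xs))
length-filter-∷ {P = P} P? x xs = by-cases (P? x)
  where
  by-cases : Dec (P x) → length (filter P? (x ∷ xs)) ≤ suc (length (filter P? xs))
  by-cases (yes px) = ≤-reflexive (cong length (filter-accept P? px))
  by-cases (no ¬px) = ≤-trans (≤-reflexive (cong length (filter-reject P? ¬px))) (n≤1+n _)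

*+-mono-< : ∀ {n a b} (i j : Fin n) → a < b → a * n + toℕ i < b * n + toℕ j
*+-mono-< {n} {a} {b} i j a<b = begin-strict
  a * n + toℕ i <⟨ +-monoʳ-< (a * n) (toℕ<n i) ⟩
  a * n + n     ≡⟨ +-comm (a * n) n ⟩
  suc a * n     ≤⟨ *-monoˡ-≤ n a<b ⟩
  b * n         ≤⟨ m≤m+n (b * n) (toℕ j) ⟩
  b * n + toℕ j ∎
  where open ≤-Reasoning

*+-injective : ∀ {n} a b (i j : Fin n) → a * n + toℕ i ≡ b * n + toℕ j → i ≡ j
*+-injective a b i j eq with <-cmp a b
... | tri< a<b _ _ = contradiction eq (<⇒≢ (*+-mono-< i j a<b))
... | tri≈ _ refl _ = toℕ-injective (+-cancelˡ-≡ (a * _) _ _ eq)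
... | tri> _ _ b<a = contradiction (sym eq) (<⇒≢ (*+-mono-< j i b<a))

module GreedyColouring
  {n d : ℕ} (Conflict : Fin n → Fin n → Set)
  (conflict-sym : ∀ {u v} → Conflict u v → Conflict v u)
  (rank : Fin n → ℕ)
  (rank-separates : ∀ {u v} → Conflict u v → rank u ≢ rank v)
  (before : Fin n → List (Fin n))
  (before-length : ∀ v → length (before v) ≤ d)
  (before-complete : ∀ {u v} → Conflict v u → rank u < rank v → u ∈ before v)
  where

  few-colours-before : ∀ (ψ : Fin n → Fin (suc d)) v → length (map ψ (before v)) ≤ d
  few-colours-before ψ v = ≤-trans (≤-reflexive (length-map ψ (before v))) (before-length v)

  free-colour : (Fin n → Fin (suc d)) → Fin n → Fin (suc d)
  free-colour ψ v = proj₁ (missing-colour (map ψ (before v)) (few-colours-before ψ v))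

  free-colour-fresh : ∀ ψ {u v} → u ∈ before v → free-colour ψ v ≢ ψ u
  free-colour-fresh ψ {u} {v} u∈ eq = proj₂ (missing-colour (map ψ (before v)) (few-colours-before ψ v))
    (subst (_∈ map ψ (before v)) (sym eq) (∈-map⁺ ψ u∈))

  stage : ℕ → Fin n → Fin (suc d)
  stage zero    v = fzero
  stage (suc m) v with rank v ℕ.≟ m
  ... | yes _ = free-colour (stage m) v
  ... | no  _ = stage m v

  private
    m<1+n∧m≢n⇒m<n : ∀ {k m} → k < suc m → k ≢ m → k < m
    m<1+n∧m≢n⇒m<n = ≤∧≢⇒< ∘ m<1+n⇒m≤n

  stage-conflict-free : ∀ m {u v} → rank u < m → rank v < m → Conflict u v → stage m u ≢ stage m v
  stage-conflict-free (suc m) {u} {v} ru rv c with rank u ℕ.≟ m | rank v ℕ.≟ m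
  ... | yes ru≡m | yes rv≡m = contradiction (trans ru≡m (sym rv≡m)) (rank-separates c)
  ... | yes ru≡m | no  rv≢m = free-colour-fresh (stage m)
    (before-complete c (subst (rank v <_) (sym ru≡m) (m<1+n∧m≢n⇒m<n rv rv≢m)))
  ... | no  ru≢m | yes rv≡m = ≢-sym (free-colour-fresh (stage m)
    (before-complete (conflict-sym c) (subst (rank u <_) (sym rv≡m) (m<1+n∧m≢n⇒m<n ru ru≢m))))
  ... | no  ru≢m | no  rv≢m =
    stage-conflict-free m (m<1+n∧m≢n⇒m<n ru ru≢m) (m<1+n∧m≢n⇒m<n rv rv≢m) c

  colouring : ∃[ φ ] ∀ {u v} → Conflict u v → φ u ≢ φ v
  colouring = stage (suc (sup rank)) , stage-conflict-free _ (s≤s (≤-sup rank _)) (s≤s (≤-sup rank _))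

module ColourClasses {a k} {A : Set a} (φ : A → Fin k) where

  count : Fin k → List A → ℕ
  count c xs = length (filter (λ y → φ y ≟ c) xs)

  count-∷-≡ : ∀ {c x} xs → φ x ≡ c → count c (x ∷ xs) ≡ suc (count c xs)
  count-∷-≡ {c} xs e = cong length (filter-accept (λ y → φ y ≟ c) e)

  count-∷-≢ : ∀ {c x} xs → φ x ≢ c → count c (x ∷ xs) ≡ count c xs
  count-∷-≢ {c} xs e = cong length (filter-reject (λ y → φ y ≟ c) e)

  ∃-odd-class : ∀ xs → length xs ≤ 3 → length xs ≢ 0 →
                (∀ {x y} → xs ≡ x ∷ y ∷ [] → φ x ≢ φ y) → ∃[ c ] Odd (count c xs)
  ∃-odd-class [] _ nonempty _ = contradiction refl nonempty
  ∃-odd-class (x ∷ []) _ _ _ = φ x , cong (_% 2) (count-∷-≡ [] refl)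
  ∃-odd-class (x ∷ y ∷ []) _ _ distinct =
    φ x , cong (_% 2) (trans (count-∷-≡ _ refl) (cong suc (count-∷-≢ [] (≢-sym (distinct refl)))))
  ∃-odd-class (x ∷ y ∷ z ∷ []) _ _ _ with φ y ≟ φ x | φ z ≟ φ x
  ... | no y≢x | no z≢x = φ x , cong (_% 2)
    (trans (count-∷-≡ _ refl) (cong suc (trans (count-∷-≢ _ y≢x) (count-∷-≢ [] z≢x))))
  ... | yes y≡x | yes z≡x = φ x , cong (_% 2)
    (trans (count-∷-≡ _ refl) (cong suc (trans (count-∷-≡ _ y≡x) (cong suc (count-∷-≡ [] z≡x)))))
  ... | yes y≡x | no z≢x = φ z , cong (_% 2)
    (trans (count-∷-≢ _ (≢-sym z≢x))
           (trans (count-∷-≢ _ (λ y≡z → z≢x (trans (sym y≡z) y≡x))) (count-∷-≡ [] refl)))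
  ... | no y≢x | yes z≡x = φ y , cong (_% 2)
    (trans (count-∷-≢ _ (≢-sym y≢x))
           (trans (count-∷-≡ _ refl) (cong suc (count-∷-≢ [] (λ z≡y → y≢x (trans (sym z≡y) z≡x))))))
  ∃-odd-class (_ ∷ _ ∷ _ ∷ _ ∷ _) (s≤s (s≤s (s≤s ()))) _ _

module _ {n} (G : Graph n) where

  adj-sym : ∀ {x y} → T (adj G x y) → T (adj G y x)
  adj-sym {x} {y} = subst T (symm G x y)

  adj⇒∈N : ∀ {x y} → T (adj G x y) → y ∈ N G x
  adj⇒∈N {x} {y} = ∈-filter⁺ (λ z → T? (adj G x z)) (∈-allFin y)

  ∈N⇒adj : ∀ {x y} → y ∈ N G x → T (adj G x y)
  ∈N⇒adj {x} y∈ = proj₂ (∈-filter⁻ (λ z → T? (adj G x z)) {xs = allFin n} y∈)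

  Deg2 : Fin n → Set
  Deg2 v = degree G v ≡ 2

  deg2? : Decidable Deg2
  deg2? v = degree G v ℕ.≟ 2

  N-unique : ∀ x → Unique (N G x)
  N-unique x = Unique.filter⁺ (λ z → T? (adj G x z)) (Unique.allFin⁺ n)

  walkLength : ∀ {x y} → Reach G x y → ℕ
  walkLength here       = 0
  walkLength (step _ w) = suc (walkLength w)

module Distance {n} (G : Graph n) (conn : Connected G)
                {p} {P : Pred (Fin n) p} (P? : Decidable P) {r} (Pr : P r) where

  Near : ℕ → Fin n → Set p
  Near zero    x = P x
  Near (suc j) x = P x ⊎ ∃[ y ] T (adj G x y) × Near j y

  near? : ∀ j → Decidable (Near j)
  near? zero    = P?
  near? (suc j) x = P? x ⊎-dec any? (λ y → T? (adj G x y) ×-dec near? j y)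

  walk-near : ∀ {x} (w : Reach G x r) → Near (walkLength G w) x
  walk-near here       = Pr
  walk-near (step a w) = inj₂ (_ , a , walk-near w)

  least-near : ∀ x → ∃[ j ] Near j x × (∀ {i} → i < j → ¬ Near i x)
  least-near x = least-witness (λ j → near? j x) (walkLength G (conn x r)) (walk-near (conn x r))

  dist : Fin n → ℕ
  dist x = proj₁ (least-near x)

  dist-minimal : ∀ {j x} → Near j x → dist x ≤ j
  dist-minimal {x = x} near = ≮⇒≥ (λ j<dist → proj₂ (proj₂ (least-near x)) j<dist near)

  dist-descends : ∀ {v} → ¬ P v → ∃[ y ] T (adj G v y) × dist y < dist v
  dist-descends {v} ¬Pv with dist v | proj₁ (proj₂ (least-near v))
  ... | zero  | Pv                   = contradiction Pv ¬Pv
  ... | suc j | inj₁ Pv              = contradiction Pv ¬Pv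
  ... | suc j | inj₂ (y , a , near) = y , a , s≤s (dist-minimal near)

module Subcubic {n} (G : Graph n) (maxdeg : ∀ x → degree G x ≤ 3) where

  Conflict : Fin n → Fin n → Set
  Conflict u v = T (adj G u v) ⊎ ∃[ z ] Deg2 G z × T (adj G z u) × T (adj G z v) × u ≢ v

  conflict-sym : ∀ {u v} → Conflict u v → Conflict v u
  conflict-sym (inj₁ a)                         = inj₁ (adj-sym G a)
  conflict-sym (inj₂ (z , dz , au , av , u≢v)) = inj₂ (z , dz , av , au , ≢-sym u≢v)

  conflict-irrefl : ∀ {u} → ¬ Conflict u u
  conflict-irrefl {u} (inj₁ a)                     = subst T (irrefl G u) a
  conflict-irrefl     (inj₂ (_ , _ , _ , _ , u≢u)) = u≢u refl

  conflict-free⇒odd : ∀ {k} (φ : Fin n → Fin k) → (∀ {u v} → Conflict u v → φ u ≢ φ v) →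
                      OddColoring G φ
  conflict-free⇒odd φ conflict-free = (λ _ _ a → conflict-free (inj₁ a)) , odd-class
    where
    open ColourClasses φ

    odd-class : ∀ x → ¬ Isolated G x → ∃[ c ] Odd (colorCount G φ x c)
    odd-class x ¬isolated = ∃-odd-class (N G x) (maxdeg x) ¬isolated distinct
      where
      distinct : ∀ {a b} → N G x ≡ a ∷ b ∷ [] → φ a ≢ φ b
      distinct {a} {b} eq with subst Unique eq (N-unique G x)
      ... | (a≢b All.∷ All.[]) ∷ _ = conflict-free (inj₂
        (x , cong length eq , ∈N⇒adj G (subst (a ∈_) (sym eq) (here refl))
           , ∈N⇒adj G (subst (b ∈_) (sym eq) (there (here refl))) , a≢b))

  module Greedy
    (rank : Fin n → ℕ) (rank-injective : Injective _≡_ _≡_ rank)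
    (deg2-after : ∀ {v y} → ¬ Deg2 G v → Deg2 G y → rank v < rank y)
    (deg2-exit : ∀ {v} → Deg2 G v → ∃[ y ] T (adj G v y) × (¬ Deg2 G y ⊎ rank v < rank y))
    where

    earlier? : ∀ v → Decidable (λ u → rank u < rank v)
    earlier? v u = rank u <? rank v

    relay : Fin n → List (Fin n)
    relay y with deg2? G y
    ... | yes _ = N G y
    ... | no  _ = []

    ∈-relay : ∀ {z u} → Deg2 G z → T (adj G z u) → u ∈ relay z
    ∈-relay {z} dz a with deg2? G z
    ... | yes _   = adj⇒∈N G a
    ... | no ¬dz = contradiction dz ¬dz

    relay-¬deg2 : ∀ {y} → ¬ Deg2 G y → relay y ≡ []
    relay-¬deg2 {y} ¬dy with deg2? G y
    ... | yes dy = contradiction dy ¬dy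
    ... | no  _  = refl

    -- v itself is in relay y when y has degree 2; the filter removes it.
    through : Fin n → Fin n → List (Fin n)
    through v y = filter (earlier? v) (y ∷ relay y)

    before : Fin n → List (Fin n)
    before v = concatMap (through v) (N G v)

    ∈-before : ∀ {u v y} → y ∈ N G v → u ∈ y ∷ relay y → rank u < rank v → u ∈ before v
    ∈-before {v = v} y∈ u∈ u<v = ∈-concat⁺′ (∈-filter⁺ (earlier? v) u∈ u<v) (∈-map⁺ (through v) y∈)

    before-complete : ∀ {u v} → Conflict v u → rank u < rank v → u ∈ before v
    before-complete (inj₁ a) = ∈-before (adj⇒∈N G a) (here refl)
    before-complete (inj₂ (z , dz , av , au , _)) =
      ∈-before (adj⇒∈N G (adj-sym G av)) (there (∈-relay dz au))

    relay-earlier-≤1 : ∀ {v y} → T (adj G v y) → length (filter (earlier? v) (relay y)) ≤ 1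
    relay-earlier-≤1 {v} {y} a with deg2? G y
    ... | no  _  = z≤n
    ... | yes dy = s≤s⁻¹ (subst (length (filter (earlier? v) (N G y)) <_) dy
                           (filter-notAll (earlier? v) (N G y) v-not-earlier))
      where
      v-not-earlier : Any.Any (λ u → ¬ rank u < rank v) (N G y)
      v-not-earlier = Any.map (λ { refl → <-irrefl refl }) (adj⇒∈N G (adj-sym G a))

    through-≤1 : ∀ {v y} → T (adj G v y) → ¬ Deg2 G y ⊎ rank v < rank y →
                 length (through v y) ≤ 1
    through-≤1 {v} {y} a (inj₁ ¬dy) rewrite relay-¬deg2 ¬dy = length-filter (earlier? v) (y ∷ [])
    through-≤1 {v} {y} a (inj₂ v<y)
      rewrite filter-reject (earlier? v) {xs = relay y} (<⇒≯ v<y) = relay-earlier-≤1 a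

    through-≤2 : ∀ {v y} → T (adj G v y) → length (through v y) ≤ 2
    through-≤2 {v} {y} a = ≤-trans (length-filter-∷ (earlier? v) y (relay y)) (s≤s (relay-earlier-≤1 a))

    before-length-¬deg2 : ∀ {v} → ¬ Deg2 G v → length (before v) ≤ 3
    before-length-¬deg2 {v} ¬dv = begin
      length (before v)  ≤⟨ length-concatMap-≤ (through v) (N G v)
                              (λ y∈ → through-≤1 (∈N⇒adj G y∈) (exit _)) ⟩
      degree G v * 1     ≡⟨ *-identityʳ _ ⟩
      degree G v         ≤⟨ maxdeg v ⟩
      3                  ∎
      where
      open ≤-Reasoning
      exit : ∀ y → ¬ Deg2 G y ⊎ rank v < rank y
      exit y with deg2? G y
      ... | yes dy  = inj₂ (deg2-after ¬dv dy)
      ... | no  ¬dy = inj₁ ¬dy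

    before-length-deg2 : ∀ {v} → Deg2 G v → length (before v) ≤ 3
    before-length-deg2 {v} dv with deg2-exit dv
    ... | y , a , exit = s≤s⁻¹ (subst (λ m → length (before v) < m * 2) dv
                           (length-concatMap-< (through v) (N G v) (adj⇒∈N G a) (s≤s (through-≤1 a exit))
                             (λ y∈ → through-≤2 (∈N⇒adj G y∈))))

    before-length : ∀ v → length (before v) ≤ 3
    before-length v with deg2? G v
    ... | yes dv  = before-length-deg2 dv
    ... | no  ¬dv = before-length-¬deg2 ¬dv

    conflict-free-colouring : ∃[ φ ] ∀ {u v} → Conflict u v → φ u ≢ φ v
    conflict-free-colouring =
      GreedyColouring.colouring Conflict conflict-sym
        rank rank-separates before before-length before-complete
      where
      rank-separates : ∀ {u v} → Conflict u v → rank u ≢ rank v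
      rank-separates c eq = conflict-irrefl (subst (Conflict _) (sym (rank-injective eq)) c)

module Ranking {n} (G : Graph n) (conn : Connected G) {r} (r-not-deg2 : ¬ Deg2 G r) where

  open Distance G conn (¬? ∘ deg2? G) r-not-deg2

  -- Not defined by `with deg2? G v`: that would also abstract the copy of it inside dist.
  key-by : ∀ {v} → Dec (Deg2 G v) → ℕ
  key-by {v} (yes _) = suc (sup dist ∸ dist v)
  key-by     (no  _) = 0

  key : Fin n → ℕ
  key v = key-by (deg2? G v)

  key-deg2 : ∀ {v} → Deg2 G v → key v ≡ suc (sup dist ∸ dist v)
  key-deg2 {v} dv = by-cases (deg2? G v)
    where
    by-cases : (d : Dec (Deg2 G v)) → key-by d ≡ suc (sup dist ∸ dist v)
    by-cases (yes _)   = refl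
    by-cases (no ¬dv) = contradiction dv ¬dv

  key-¬deg2 : ∀ {v} → ¬ Deg2 G v → key v ≡ 0
  key-¬deg2 {v} ¬dv = by-cases (deg2? G v)
    where
    by-cases : (d : Dec (Deg2 G v)) → key-by d ≡ 0
    by-cases (yes dv) = contradiction dv ¬dv
    by-cases (no  _)  = refl

  rank : Fin n → ℕ
  rank v = key v * n + toℕ v

  rank-injective : Injective _≡_ _≡_ rank
  rank-injective {u} {v} = *+-injective (key u) (key v) u v

  deg2-after : ∀ {v y} → ¬ Deg2 G v → Deg2 G y → rank v < rank y
  deg2-after {v} {y} ¬dv dy =
    *+-mono-< v y (subst₂ _<_ (sym (key-¬deg2 ¬dv)) (sym (key-deg2 dy)) z<s)

  deg2-exit : ∀ {v} → Deg2 G v → ∃[ y ] T (adj G v y) × (¬ Deg2 G y ⊎ rank v < rank y)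
  deg2-exit {v} dv with dist-descends (λ ¬dv → ¬dv dv)
  ... | y , a , closer = y , a , exit (deg2? G y)
    where
    exit : Dec (Deg2 G y) → ¬ Deg2 G y ⊎ rank v < rank y
    exit (no ¬dy) = inj₁ ¬dy
    exit (yes dy) = inj₂ (*+-mono-< v y (subst₂ _<_ (sym (key-deg2 dv)) (sym (key-deg2 dy))
                                          (s≤s (∸-monoʳ-< closer (≤-sup dist v)))))

proposition5 : ∀ {n} (G : Graph n) → Connected G → MaxDegree G 3 →
    OddChromaticAtMost G 4
proposition5 G conn (maxdeg , r , deg-r≡3) =
  let φ , conflict-free = conflict-free-colouring in φ , conflict-free⇒odd φ conflict-free
  where
  r-not-deg2 : ¬ Deg2 G r
  r-not-deg2 deg-r≡2 = contradiction (trans (sym deg-r≡3) deg-r≡2) λ ()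

  open Ranking G conn r-not-deg2
  open Subcubic G maxdeg
  open Greedy rank rank-injective deg2-after deg2-exit
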